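{- Let $m\ge1$ be an integer and let $T$ be a blossom tree in which the degrees of all vertices are multiples of $m$. Let $T'$ be obtained from $T$ by replacing at most $m-1$ non-root leaves of $T$ by edges, each ending at a new black vertex (of degree $1$). Then $T'$ is still a blossom tree.
   Context: All maps are planar, connected, considered up to orientation-preserving homeomorphism, and bipartite: vertices are black or white and each edge joins a black and a white vertex. Maps may carry half-edges attached to single vertices and lying in the infinite face. A half-edge at a white vertex is a leaf; one at a black vertex is a bud. Degrees count edges and half-edges. A tree is such a map with a single face, rooted at one of its half-edges. Its charge is the number of leaves minus the number of buds, not counting the root half-edge. For an edge $e$ of a tree $T$, cutting $e$ into a leaf at its white end and a bud at its black end yields $T_e^\bullet$ (containing the black end) and $T_e^\circ$ (containing the white end), each rooted at its new half-edge. The lower subtree at $e$ is the one not containing the root. A blossom tree is a tree such that, for every edge $e$: the lower subtree has charge $\ge0$ if it is $T_e^\circ$, and $\le1$ if it is $T_e^\bullet$. -}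

module Defs where

open import Data.Nat using (ℕ; zero; suc; _+_)
open import Data.Nat.Divisibility using (_∣_)
open import Data.Integer as ℤ using (ℤ; +_; -_)
open import Data.List using (List; []; _∷_; length)
open import Data.Product using (_×_)
open import Data.Unit using (⊤)

data Color : Set where
  white black : Color

opp : Color → Color
opp white = black
opp black = white

-- A plane tree hanging below a vertex of colour c.  The vertex is reached
-- through a distinguished "parent" half-edge or edge (for the root vertex:
-- the root half-edge; otherwise: the edge to its parent).  The list gives the
-- remaining incident items in planar (cyclic) order, starting right after the
-- parent item.  Each item is either a half-edge (a leaf if c = white, a bud
-- if c = black) or an edge to a child vertex of the opposite colour.
data Node : Color → Set
data Item : Color → Set

data Node where
  node : ∀ {c} → List (Item c) → Node c

data Item where
  half : ∀ {c} → Item c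
  edge : ∀ {c} → Node (opp c) → Item c

record Tree : Set where
  constructor tree
  field
    colour : Color
    root   : Node colour

degree : ∀ {c} → Node c → ℕ
degree (node is) = suc (length is)

-- Charge of the tree hanging below a vertex (= the tree rooted at the parent
-- item): leaves minus buds, not counting the root (parent) half-edge.
chargeN : ∀ {c} → Node c → ℤ
chargeL : ∀ {c} → List (Item c) → ℤ
halfCharge : Color → ℤ
halfCharge white = + 1
halfCharge black = - (+ 1)

chargeN (node is) = chargeL is
chargeL [] = + 0
chargeL {c} (half ∷ is) = halfCharge c ℤ.+ chargeL is
chargeL (edge n ∷ is) = chargeN n ℤ.+ chargeL is

charge : Tree → ℤ
charge (tree c n) = chargeN n

-- Condition on the lower subtree at an edge whose lower endpoint has colour c:
-- if c = white the lower subtree is T_e^∘ and must have charge ≥ 0;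
-- if c = black the lower subtree is T_e^• and must have charge ≤ 1.
-- The lower subtree is exactly the tree hanging below the lower endpoint,
-- rooted at the new half-edge replacing e.
LowerOK : (c : Color) → Node c → Set
LowerOK white n = + 0 ℤ.≤ chargeN n
LowerOK black n = chargeN n ℤ.≤ + 1

BlossomN : ∀ {c} → Node c → Set
BlossomL : ∀ {c} → List (Item c) → Set
BlossomN (node is) = BlossomL is
BlossomL [] = ⊤
BlossomL (half ∷ is) = BlossomL is
BlossomL {c} (edge n ∷ is) = LowerOK (opp c) n × BlossomN n × BlossomL is

IsBlossomTree : Tree → Set
IsBlossomTree (tree c n) = BlossomN n

DegDivN : ℕ → ∀ {c} → Node c → Set
DegDivL : ℕ → ∀ {c} → List (Item c) → Set
DegDivN m (node is) = (m ∣ suc (length is)) × DegDivL m is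
DegDivL m [] = ⊤
DegDivL m (half ∷ is) = DegDivL m is
DegDivL m (edge n ∷ is) = DegDivN m n × DegDivL m is

AllDegreesDivisibleBy : ℕ → Tree → Set
AllDegreesDivisibleBy m (tree c n) = DegDivN m n

data ReplN : ∀ {c} → Node c → Node c → ℕ → Set
data ReplL : ∀ {c} → List (Item c) → List (Item c) → ℕ → Set

data ReplN where
  node : ∀ {c} {is is' : List (Item c)} {k} →
         ReplL is is' k → ReplN (node is) (node is') k

data ReplL where
  []   : ∀ {c} → ReplL {c} [] [] 0
  keep : ∀ {c} {is is' : List (Item c)} {k} →
         ReplL is is' k → ReplL (half ∷ is) (half ∷ is') k
  grow : ∀ {is is' : List (Item white)} {k} →
         ReplL is is' k → ReplL (half ∷ is) (edge (node []) ∷ is') (suc k)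
  down : ∀ {c} {n n' : Node (opp c)} {is is' : List (Item c)} {j k} →
         ReplN n n' j → ReplL is is' k → ReplL (edge n ∷ is) (edge n' ∷ is') (j + k)

data Replaced : ℕ → Tree → Tree → Set where
  repl : ∀ {c} {n n' : Node c} {k} → ReplN n n' k → Replaced k (tree c n) (tree c n')

-- Weighting every vertex by ±(its degree), + for white, counts each edge once with
-- each sign, so the signed degree sum of a subtree is its leaves minus buds including
-- its root half-edge: chargeN n + halfCharge c.  Degrees divisible by m make this a
-- multiple of m.  A white lower subtree of charge ≥ 0 thus has charge ≡ −1 mod m,
-- i.e. ≥ m − 1, which survives losing at most m − 1 leaves; black lower subtrees only
-- lose charge, and the new black leaves have charge 0.
module Submission where

open import Defs
open import Data.Nat using (ℕ; suc; _≤_; _∸_; z≤n; s≤s⁻¹)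
open import Data.Nat.Properties using (m+n≤o⇒m≤o; m+n≤o⇒n≤o; +-comm)
open import Data.Nat.Divisibility using (_∣0; ∣⇒≤) renaming (_∣_ to _∣ℕ_)
open import Data.Integer using (ℤ; +_; -_; _+_; _*_; 0ℤ; +≤+) renaming (_≤_ to _≤ℤ_)
open import Data.Integer.Properties as ℤ using (+-0-abelianGroup)
open import Data.Integer.Divisibility.Signed using (_∣_; ∣ᵤ⇒∣; ∣⇒∣ᵤ; ∣m∣n⇒∣m+n; ∣n⇒∣m*n)
open import Data.Integer.Tactic.RingSolver using (solve-∀)
open import Algebra.Bundles using (AbelianGroup)
open import Algebra.Properties.Group (AbelianGroup.group +-0-abelianGroup) using (//-rightDividesʳ)
open import Data.List using (List; []; _∷_; length)
open import Data.Product using (_,_)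
open import Data.Unit using (tt)
open import Relation.Binary.PropositionalEquality

halfCharge-opp : ∀ c → halfCharge (opp c) ≡ - halfCharge c
halfCharge-opp white = refl
halfCharge-opp black = refl

signedDegreeSumN : ∀ {c} → Node c → ℤ
signedDegreeSumL : ∀ {c} → List (Item c) → ℤ
signedDegreeSumN {c} (node is) = halfCharge c * + degree (node is) + signedDegreeSumL is
signedDegreeSumL [] = 0ℤ
signedDegreeSumL (half ∷ is) = signedDegreeSumL is
signedDegreeSumL (edge n ∷ is) = signedDegreeSumN n + signedDegreeSumL is

chargeL≡signedDegreeSumL : ∀ {c} (is : List (Item c)) →
  chargeL is ≡ halfCharge c * + length is + signedDegreeSumL is
chargeN+halfCharge≡signedDegreeSumN : ∀ {c} (n : Node c) →
  chargeN n + halfCharge c ≡ signedDegreeSumN n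

chargeL≡signedDegreeSumL {c} [] = sym (cong (_+ 0ℤ) (ℤ.*-zeroʳ (halfCharge c)))
chargeL≡signedDegreeSumL {c} (half ∷ is) = begin
  halfCharge c + chargeL is
    ≡⟨ cong (λ x → halfCharge c + x) (chargeL≡signedDegreeSumL is) ⟩
  halfCharge c + (halfCharge c * + length is + signedDegreeSumL is)
    ≡⟨ shift (halfCharge c) (+ length is) (signedDegreeSumL is) ⟩
  halfCharge c * + suc (length is) + signedDegreeSumL is ∎
  where
  open ≡-Reasoning
  shift : ∀ h l s → h + (h * l + s) ≡ h * (+ 1 + l) + s
  shift = solve-∀
chargeL≡signedDegreeSumL {c} (edge n ∷ is) = begin
  chargeN n + chargeL is
    ≡⟨ cong (λ x → chargeN n + x) (chargeL≡signedDegreeSumL is) ⟩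
  chargeN n + (halfCharge c * + length is + signedDegreeSumL is)
    ≡⟨ regroup (chargeN n) (halfCharge c) (+ length is) (signedDegreeSumL is) ⟩
  (chargeN n + - halfCharge c) + halfCharge c * + suc (length is) + signedDegreeSumL is
    ≡⟨ cong (λ x → (chargeN n + x) + halfCharge c * + suc (length is) + signedDegreeSumL is)
            (sym (halfCharge-opp c)) ⟩
  (chargeN n + halfCharge (opp c)) + halfCharge c * + suc (length is) + signedDegreeSumL is
    ≡⟨ cong (λ x → x + halfCharge c * + suc (length is) + signedDegreeSumL is)
            (chargeN+halfCharge≡signedDegreeSumN n) ⟩
  signedDegreeSumN n + halfCharge c * + suc (length is) + signedDegreeSumL is
    ≡⟨ swap (signedDegreeSumN n) (halfCharge c * + suc (length is)) (signedDegreeSumL is) ⟩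
  halfCharge c * + suc (length is) + (signedDegreeSumN n + signedDegreeSumL is) ∎
  where
  open ≡-Reasoning
  regroup : ∀ a h l s → a + (h * l + s) ≡ (a + - h) + h * (+ 1 + l) + s
  regroup = solve-∀
  swap : ∀ a b s → a + b + s ≡ b + (a + s)
  swap = solve-∀

chargeN+halfCharge≡signedDegreeSumN {c} (node is) = begin
  chargeL is + halfCharge c
    ≡⟨ cong (_+ halfCharge c) (chargeL≡signedDegreeSumL is) ⟩
  halfCharge c * + length is + signedDegreeSumL is + halfCharge c
    ≡⟨ shift (halfCharge c) (+ length is) (signedDegreeSumL is) ⟩
  halfCharge c * + suc (length is) + signedDegreeSumL is ∎
  where
  open ≡-Reasoning
  shift : ∀ h l s → h * l + s + h ≡ h * (+ 1 + l) + s
  shift = solve-∀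

DegDivN⇒∣signedDegreeSumN : ∀ {m c} (n : Node c) → DegDivN m n → + m ∣ signedDegreeSumN n
DegDivL⇒∣signedDegreeSumL : ∀ {m c} (is : List (Item c)) → DegDivL m is → + m ∣ signedDegreeSumL is
DegDivN⇒∣signedDegreeSumN {c = c} (node is) (m∣deg , d) =
  ∣m∣n⇒∣m+n (∣n⇒∣m*n (halfCharge c) (∣ᵤ⇒∣ m∣deg)) (DegDivL⇒∣signedDegreeSumL is d)
DegDivL⇒∣signedDegreeSumL {m} [] _ = ∣ᵤ⇒∣ (m ∣0)
DegDivL⇒∣signedDegreeSumL (half ∷ is) d = DegDivL⇒∣signedDegreeSumL is d
DegDivL⇒∣signedDegreeSumL (edge n ∷ is) (dn , d) =
  ∣m∣n⇒∣m+n (DegDivN⇒∣signedDegreeSumN n dn) (DegDivL⇒∣signedDegreeSumL is d)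

DegDivN⇒∣chargeN+halfCharge : ∀ {m c} (n : Node c) → DegDivN m n → + m ∣ chargeN n + halfCharge c
DegDivN⇒∣chargeN+halfCharge n d =
  subst (+ _ ∣_) (sym (chargeN+halfCharge≡signedDegreeSumN n)) (DegDivN⇒∣signedDegreeSumN n d)

chargeN-ReplN : ∀ {c} {n n' : Node c} {j} → ReplN n n' j → chargeN n ≡ chargeN n' + + j
chargeL-ReplL : ∀ {c} {is is' : List (Item c)} {j} → ReplL is is' j → chargeL is ≡ chargeL is' + + j
chargeN-ReplN (node r) = chargeL-ReplL r
chargeL-ReplL [] = refl
chargeL-ReplL {c} (keep {is' = is'} {k} r) =
  trans (cong (λ x → halfCharge c + x) (chargeL-ReplL r)) (sym (ℤ.+-assoc (halfCharge c) (chargeL is') (+ k)))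
chargeL-ReplL (grow {is' = is'} {k} r) =
  trans (cong (λ x → + 1 + x) (chargeL-ReplL r)) (regroup (chargeL is') (+ k))
  where
  regroup : ∀ a b → + 1 + (a + b) ≡ 0ℤ + a + (+ 1 + b)
  regroup = solve-∀
chargeL-ReplL (down {n' = n'} {is' = is'} {j} {k} rn r) =
  trans (cong₂ _+_ (chargeN-ReplN rn) (chargeL-ReplL r)) (regroup (chargeN n') (+ j) (chargeL is') (+ k))
  where
  regroup : ∀ a j b k → a + j + (b + k) ≡ a + b + (j + k)
  regroup = solve-∀

0≤i∧1+m∣i+1⇒m≤i : ∀ {m i} → 0ℤ ≤ℤ i → + suc m ∣ i + + 1 → + m ≤ℤ i
0≤i∧1+m∣i+1⇒m≤i {m} {+ n} _ d =
  +≤+ (s≤s⁻¹ (∣⇒≤ (subst (suc m ∣ℕ_) (+-comm n 1) (∣⇒∣ᵤ d))))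

LowerOK-ReplN : ∀ {m} c {n n' : Node c} {j} → ReplN n n' j → j ≤ m →
                DegDivN (suc m) n → LowerOK c n → LowerOK c n'
LowerOK-ReplN {m} white {n} {n'} {j} r j≤m d 0≤n =
  subst (0ℤ ≤ℤ_) (//-rightDividesʳ (+ j) (chargeN n'))
    (ℤ.i≤j⇒0≤j-i (subst (+ j ≤ℤ_) (chargeN-ReplN r) (ℤ.≤-trans (+≤+ j≤m) m≤n)))
  where
  m≤n : + m ≤ℤ chargeN n
  m≤n = 0≤i∧1+m∣i+1⇒m≤i 0≤n (DegDivN⇒∣chargeN+halfCharge n d)
LowerOK-ReplN black {n' = n'} {j} r _ _ n≤1 =
  ℤ.≤-trans (ℤ.i≤i+j (chargeN n') (+ j)) (subst (_≤ℤ + 1) (chargeN-ReplN r) n≤1)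

BlossomN-ReplN : ∀ {m c} {n n' : Node c} {j} → ReplN n n' j → j ≤ m →
                 DegDivN (suc m) n → BlossomN n → BlossomN n'
BlossomL-ReplL : ∀ {m c} {is is' : List (Item c)} {j} → ReplL is is' j → j ≤ m →
                 DegDivL (suc m) is → BlossomL is → BlossomL is'
BlossomN-ReplN (node r) j≤m (_ , d) b = BlossomL-ReplL r j≤m d b
BlossomL-ReplL [] _ _ _ = tt
BlossomL-ReplL (keep r) j≤m d b = BlossomL-ReplL r j≤m d b
BlossomL-ReplL (grow r) 1+k≤m d b =
  +≤+ z≤n , tt , BlossomL-ReplL r (m+n≤o⇒n≤o 1 1+k≤m) d b
BlossomL-ReplL {m} {c} (down {j = j} {k} rn r) j+k≤m (dn , d) (ok , bn , b) =
  LowerOK-ReplN (opp c) rn j≤m dn ok , BlossomN-ReplN rn j≤m dn bn , BlossomL-ReplL r k≤m d b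
  where
  j≤m : j ≤ m
  j≤m = m+n≤o⇒m≤o j j+k≤m
  k≤m : k ≤ m
  k≤m = m+n≤o⇒n≤o j j+k≤m

lemma10 : (m : ℕ) → 1 ≤ m → (T T' : Tree) → IsBlossomTree T →
          AllDegreesDivisibleBy m T → (k : ℕ) → k ≤ m ∸ 1 →
          Replaced k T T' → IsBlossomTree T'
lemma10 (suc m) _ (tree c n) (tree .c n') b d k k≤m (repl r) = BlossomN-ReplN r k≤m d b
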